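{- Let $f:\{0,1\}^n\to\{0,1\}$ be given by a DNF representation in compact form with width $d_\wedge$ and parameter $\Gamma$. Then $d_\wedge-\Gamma\le \mathrm{s}_1(f)\le d_\wedge$.
   Context: For $x\in\{0,1\}^n$, $x^i$ flips bit $i$; $\mathrm{s}(f,x)=|\{i: f(x)\ne f(x^i)\}|$ and $\mathrm{s}_1(f)=\max_{f(x)=1}\mathrm{s}(f,x)$. For $B\subseteq[n]$, $x^B$ flips bits in $B$; $\mathrm{bs}(f,x)$ is the maximum number of pairwise disjoint $B_j\subseteq[n]$ with $f(x^{B_j})\neq f(x)$, and $\mathrm{bs}_0(f)=\max_{f(x)=0}\mathrm{bs}(f,x)$. A DNF representation is an OR of terms $\wedge_1,\dots,\wedge_{d_\vee}$, each an AND of literals, no term containing a variable and its negation; $A_i$ (resp. $\overline{A}_i$) is the set of variables appearing unnegated (resp. negated) in $\wedge_i$; $d_{\wedge_i}=|A_i|+|\overline{A}_i|$ and the width is $d_\wedge=\max_i d_{\wedge_i}$; $S_i$ is the set of assignments satisfying $\wedge_i$. Compact form: (a) $f(0^n)=0$, (b) $\mathrm{bs}_0(f)=\mathrm{bs}(f,0^n)$, (c) $S_i\setminus\bigcup_{j\ne i}S_j\ne\emptyset$ for all $i$. For each $i$, $\Gamma_i=\{j: |A_i\cap\overline{A}_j|+|A_j\cap\overline{A}_i|=1\}$ and $\Gamma=\max_i|\Gamma_i|$. -}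

module Defs where

open import Data.Bool using (Bool; true; false; not; _∧_; _∨_; _xor_; if_then_else_)
open import Data.Nat using (ℕ; zero; suc; _+_; _⊔_; _≤_)
open import Data.Fin using (Fin)
open import Data.Vec using (Vec; []; _∷_; lookup; replicate; zipWith; updateAt)
open import Data.List using (List; []; _∷_; map; _++_; foldr)
open import Data.Product using (Σ; ∃; _×_; _,_)
open import Data.Fin.Subset using (Subset; _∈_)
open import Relation.Binary.PropositionalEquality using (_≡_; _≢_)
open import Relation.Nullary using (¬_)

-- Inputs x ∈ {0,1}^n are Vec Bool n (true = 1).
Input : ℕ → Set
Input n = Vec Bool n

BoolFun : ℕ → Set
BoolFun n = Input n → Bool

countFin : ∀ {n} → (Fin n → Bool) → ℕ
countFin {zero}  p = 0
countFin {suc n} p = (if p Fin.zero then 1 else 0) + countFin (λ i → p (Fin.suc i))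

maxFin : ∀ {n} → (Fin n → ℕ) → ℕ
maxFin {zero}  g = 0
maxFin {suc n} g = g Fin.zero ⊔ maxFin (λ i → g (Fin.suc i))

-- Literal status of a variable in a term: appears unnegated, negated, or not at all.
-- (This encoding builds in "no term contains a variable and its negation".)
data Lit : Set where
  pos neg absent : Lit

-- A term (AND of literals) on n variables; A = {k | t k = pos}, Ā = {k | t k = neg}.
Term : ℕ → Set
Term n = Fin n → Lit

DNF : ℕ → ℕ → Set
DNF n m = Fin m → Term n

litSat : Lit → Bool → Bool
litSat pos    b = b
litSat neg    b = not b
litSat absent b = true

allFinB : ∀ {n} → (Fin n → Bool) → Bool
allFinB {zero}  p = true
allFinB {suc n} p = p Fin.zero ∧ allFinB (λ i → p (Fin.suc i))

anyFinB : ∀ {n} → (Fin n → Bool) → Bool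
anyFinB {zero}  p = false
anyFinB {suc n} p = p Fin.zero ∨ anyFinB (λ i → p (Fin.suc i))

satTerm : ∀ {n} → Term n → Input n → Bool
satTerm t x = allFinB (λ k → litSat (t k) (lookup x k))

eval : ∀ {n m} → DNF n m → BoolFun n
eval D x = anyFinB (λ i → satTerm (D i) x)

isPos isNeg isLit : Lit → Bool
isPos pos = true
isPos _   = false
isNeg neg = true
isNeg _   = false
isLit absent = false
isLit _      = true

termWidth : ∀ {n} → Term n → ℕ
termWidth t = countFin (λ k → isLit (t k))

-- d_∧ = max_i d_{∧_i}  (0 if there are no terms)
width : ∀ {n m} → DNF n m → ℕ
width D = maxFin (λ i → termWidth (D i))

conflicts : ∀ {n} → Term n → Term n → ℕ
conflicts s t = countFin (λ k → isPos (s k) ∧ isNeg (t k))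
              + countFin (λ k → isPos (t k) ∧ isNeg (s k))

isOne : ℕ → Bool
isOne 1 = true
isOne _ = false

GammaSize : ∀ {n m} → DNF n m → Fin m → ℕ
GammaSize D i = countFin (λ j → isOne (conflicts (D i) (D j)))

Gamma : ∀ {n m} → DNF n m → ℕ
Gamma D = maxFin (GammaSize D)

flipBit : ∀ {n} → Fin n → Input n → Input n
flipBit i x = updateAt x i not

flipBlock : ∀ {n} → Subset n → Input n → Input n
flipBlock B x = zipWith _xor_ x B

sens : ∀ {n} → BoolFun n → Input n → ℕ
sens f x = countFin (λ i → f x xor f (flipBit i x))

allInputs : ∀ n → List (Input n)
allInputs zero    = [] ∷ []
allInputs (suc n) = map (true ∷_) (allInputs n) ++ map (false ∷_) (allInputs n)

-- s_1(f) = max_{f(x)=1} s(f,x)  (0 if f has no 1-input)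
s1 : ∀ {n} → BoolFun n → ℕ
s1 {n} f = foldr (λ x r → (if f x then sens f x else 0) ⊔ r) 0 (allInputs n)

Blocks : ∀ {n} → BoolFun n → Input n → ℕ → Set
Blocks {n} f x k =
  Σ (Fin k → Subset n) λ B →
    (∀ a b → a ≢ b → ∀ v → ¬ (v ∈ B a × v ∈ B b)) ×
    (∀ a → f (flipBlock (B a) x) ≢ f x)

IsBs : ∀ {n} → BoolFun n → Input n → ℕ → Set
IsBs f x b = Blocks f x b × (∀ k → Blocks f x k → k ≤ b)

IsBs0 : ∀ {n} → BoolFun n → ℕ → Set
IsBs0 f b = (∃ λ x → f x ≡ false × IsBs f x b)
          × (∀ x → f x ≡ false → ∀ k → Blocks f x k → k ≤ b)

Compact : ∀ {n m} → DNF n m → Set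
Compact {n} {m} D =
  (eval D (replicate n false) ≡ false) ×
  (∃ λ b → IsBs0 (eval D) b × IsBs (eval D) (replicate n false) b) ×
  (∀ i → ∃ λ x → satTerm (D i) x ≡ true × (∀ j → j ≢ i → satTerm (D j) x ≡ false))

-- Upper bound: if x satisfies the term ∧ᵢ, flipping a variable outside ∧ᵢ keeps ∧ᵢ, hence f,
-- true, so every sensitive bit of x is a variable of ∧ᵢ.
-- Lower bound: take x satisfying ∧ᵢ and no other term (compactness (c)). For each variable k
-- of ∧ᵢ either f(xᵏ) = 0, or xᵏ satisfies some ∧ⱼ with j ≠ i; then ∧ⱼ contains k with the
-- opposite sign and agrees with ∧ᵢ everywhere else, so j ∈ Γᵢ and k is the unique conflict of
-- i and j. Counting each j ∈ Γᵢ once through its unique conflict gives d_{∧ᵢ} ≤ s(f,x) + |Γᵢ|.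
module Submission where

open import Defs
open import Data.Bool using (Bool; true; false; not; _∧_; _xor_; if_then_else_)
open import Data.Fin using (Fin; zero; suc; punchIn)
open import Data.Fin.Properties using (_≟_; punchInᵢ≢i)
open import Data.List using ([]; _∷_; foldr)
open import Data.List.Membership.Propositional using (_∈_)
open import Data.List.Membership.Propositional.Properties using (∈-map⁺; ∈-++⁺ˡ; ∈-++⁺ʳ)
open import Data.List.Relation.Unary.Any using (here; there)
open import Data.Nat using (ℕ; _+_; _*_; _⊔_; _≤_; _∸_; z≤n; s≤s)
open import Data.Nat.Properties using (≤-trans; ≤-reflexive; +-mono-≤; m≤m+n; m≤n+m; +-identityʳ; +-comm; m≤m⊔n; m≤n⊔m; ⊔-lub; m≤n+o⇒m∸n≤o; +-*-semiring; module ≤-Reasoning)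
open import Algebra.Properties.Semiring.Sum +-*-semiring using (sum; sum-cong-≗; sum-remove; sum-replicate-zero; ∑-distrib-+; ∑-comm; *-distribˡ-sum)
open import Data.Product using (_×_; _,_; ∃; proj₁; proj₂)
open import Data.Vec using ([]; _∷_; lookup)
open import Data.Vec.Properties using (lookup∘updateAt; lookup∘updateAt′)
open import Function using (_∘_)
open import Relation.Binary.PropositionalEquality
open import Relation.Nullary using (¬_; yes; no)

fromBool : Bool → ℕ
fromBool b = if b then 1 else 0

fromBool≤1 : ∀ b → fromBool b ≤ 1
fromBool≤1 true  = s≤s z≤n
fromBool≤1 false = z≤n

fromBool-isOne-* : ∀ c → fromBool (isOne c) * c ≡ fromBool (isOne c)
fromBool-isOne-* 0                 = refl
fromBool-isOne-* 1                 = refl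
fromBool-isOne-* (ℕ.suc (ℕ.suc c)) = refl

countFin≡sum : ∀ {n} (p : Fin n → Bool) → countFin p ≡ sum (fromBool ∘ p)
countFin≡sum {ℕ.zero}  p = refl
countFin≡sum {ℕ.suc n} p = cong (fromBool (p zero) +_) (countFin≡sum (p ∘ suc))

sum-mono-≤ : ∀ {n} {f g : Fin n → ℕ} → (∀ k → f k ≤ g k) → sum f ≤ sum g
sum-mono-≤ {ℕ.zero}  f≤g = z≤n
sum-mono-≤ {ℕ.suc n} f≤g = +-mono-≤ (f≤g zero) (sum-mono-≤ (f≤g ∘ suc))

≤-sum : ∀ {n} (f : Fin n → ℕ) k → f k ≤ sum f
≤-sum f zero    = m≤m+n (f zero) _
≤-sum f (suc k) = ≤-trans (≤-sum (f ∘ suc) k) (m≤n+m _ (f zero))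

sum-single : ∀ {n} (f : Fin n → ℕ) k → (∀ l → l ≢ k → f l ≡ 0) → sum f ≡ f k
sum-single {ℕ.suc n} f k f≡0 = begin
  sum f                          ≡⟨ sum-remove {i = k} f ⟩
  f k + sum (f ∘ punchIn k)      ≡⟨ cong (f k +_) (sum-cong-≗ (λ l → f≡0 (punchIn k l) (punchInᵢ≢i k l))) ⟩
  f k + sum {n} (λ _ → 0)        ≡⟨ cong (f k +_) (sum-replicate-zero n) ⟩
  f k + 0                        ≡⟨ +-identityʳ (f k) ⟩
  f k                            ∎
  where open ≡-Reasoning

maxFin-upper : ∀ {n} (g : Fin n → ℕ) i → g i ≤ maxFin g
maxFin-upper g zero    = m≤m⊔n (g zero) _
maxFin-upper g (suc i) = ≤-trans (maxFin-upper (g ∘ suc) i) (m≤n⊔m (g zero) _)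

maxFin-lub : ∀ {n} (g : Fin n → ℕ) {b} → (∀ i → g i ≤ b) → maxFin g ≤ b
maxFin-lub {ℕ.zero}  g g≤b = z≤n
maxFin-lub {ℕ.suc n} g g≤b = ⊔-lub (g≤b zero) (maxFin-lub (g ∘ suc) (g≤b ∘ suc))

allFinB-sound : ∀ {n} (p : Fin n → Bool) → allFinB p ≡ true → ∀ k → p k ≡ true
allFinB-sound {ℕ.suc n} p all k with p zero in p0
allFinB-sound {ℕ.suc n} p all zero    | true = p0
allFinB-sound {ℕ.suc n} p all (suc k) | true = allFinB-sound (p ∘ suc) all k

allFinB-complete : ∀ {n} (p : Fin n → Bool) → (∀ k → p k ≡ true) → allFinB p ≡ true
allFinB-complete {ℕ.zero}  p all = refl
allFinB-complete {ℕ.suc n} p all rewrite all zero = allFinB-complete (p ∘ suc) (all ∘ suc)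

anyFinB-sound : ∀ {n} (p : Fin n → Bool) → anyFinB p ≡ true → ∃ λ k → p k ≡ true
anyFinB-sound {ℕ.suc n} p any with p zero in p0
... | true  = zero , p0
... | false with anyFinB-sound (p ∘ suc) any
...   | k , pk = suc k , pk

anyFinB-complete : ∀ {n} (p : Fin n → Bool) k → p k ≡ true → anyFinB p ≡ true
anyFinB-complete p zero    pk rewrite pk = refl
anyFinB-complete p (suc k) pk with p zero
... | true  = refl
... | false = anyFinB-complete (p ∘ suc) k pk

lookup-flipBit-self : ∀ {n} k (x : Input n) → lookup (flipBit k x) k ≡ not (lookup x k)
lookup-flipBit-self k x = lookup∘updateAt k x

lookup-flipBit-outside : ∀ {n} {k l} (x : Input n) → l ≢ k → lookup (flipBit k x) l ≡ lookup x l
lookup-flipBit-outside {k = k} {l} x l≢k = lookup∘updateAt′ l k l≢k x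

∈-allInputs : ∀ {n} (x : Input n) → x ∈ allInputs n
∈-allInputs []            = here refl
∈-allInputs (true ∷ x)    = ∈-++⁺ˡ (∈-map⁺ (true ∷_) (∈-allInputs x))
∈-allInputs {ℕ.suc n} (false ∷ x) = ∈-++⁺ʳ _ (∈-map⁺ (false ∷_) (∈-allInputs x))

if-≤ : ∀ c {m b} → (c ≡ true → m ≤ b) → (if c then m else 0) ≤ b
if-≤ true  m≤b = m≤b refl
if-≤ false _   = z≤n

s1-lub : ∀ {n} (f : BoolFun n) {b} → (∀ x → f x ≡ true → sens f x ≤ b) → s1 f ≤ b
s1-lub {n} f {b} bound = go (allInputs n)
  where
  onInput : ∀ x → (if f x then sens f x else 0) ≤ b
  onInput x = if-≤ (f x) (bound x)
  go : ∀ xs → foldr (λ x r → (if f x then sens f x else 0) ⊔ r) 0 xs ≤ b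
  go []       = z≤n
  go (x ∷ xs) = ⊔-lub (onInput x) (go xs)

sens≤s1 : ∀ {n} (f : BoolFun n) x → f x ≡ true → sens f x ≤ s1 f
sens≤s1 {n} f x fx = subst (_≤ s1 f) (cong (λ b → if b then sens f x else 0) fx) (go (∈-allInputs x))
  where
  G : Input n → ℕ
  G y = if f y then sens f y else 0
  go : ∀ {xs} → x ∈ xs → G x ≤ foldr (λ y r → G y ⊔ r) 0 xs
  go (here refl)         = m≤m⊔n (G x) _
  go {y ∷ _} (there x∈xs) = ≤-trans (go x∈xs) (m≤n⊔m (G y) _)

Sat : ∀ {n} → Term n → Input n → Set
Sat t x = ∀ k → litSat (t k) (lookup x k) ≡ true

satTerm-sound : ∀ {n} (t : Term n) x → satTerm t x ≡ true → Sat t x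
satTerm-sound t x = allFinB-sound _

isLit≡false⇒absent : ∀ {L} → isLit L ≡ false → L ≡ absent
isLit≡false⇒absent {absent} _ = refl

satTerm-agreeOutside : ∀ {n} (t : Term n) (y z : Input n) k → isLit (t k) ≡ false →
  (∀ l → l ≢ k → lookup z l ≡ lookup y l) → Sat t y → satTerm t z ≡ true
satTerm-agreeOutside t y z k k∉t z≈y sat = allFinB-complete _ sat′
  where
  sat′ : Sat t z
  sat′ l with l ≟ k
  ... | yes refl rewrite isLit≡false⇒absent k∉t = refl
  ... | no l≢k   = trans (cong (litSat (t l)) (z≈y l l≢k)) (sat l)

litSat-not : ∀ {a} b → isLit a ≡ true → litSat a b ≡ true → litSat a (not b) ≡ false
litSat-not {pos}    true  _  _  = refl
litSat-not {neg}    false _  _  = refl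
litSat-not {pos}    false _  ()
litSat-not {neg}    true  _  ()
litSat-not {absent} _     () _

Sat-flipBit : ∀ {n} (t : Term n) x k → isLit (t k) ≡ true → Sat t x → ¬ Sat t (flipBit k x)
Sat-flipBit t x k k∈t sat sat′
  with trans (sym (litSat-not (lookup x k) k∈t (sat k)))
             (subst (λ b → litSat (t k) b ≡ true) (lookup-flipBit-self k x) (sat′ k))
... | ()

litConflict : Lit → Lit → ℕ
litConflict a c = fromBool (isPos a ∧ isNeg c) + fromBool (isPos c ∧ isNeg a)

conflicts≡sum : ∀ {n} (s t : Term n) → conflicts s t ≡ sum (λ k → litConflict (s k) (t k))
conflicts≡sum {n} s t =
  trans (cong₂ _+_ (countFin≡sum st) (countFin≡sum ts)) (sym (∑-distrib-+ (fromBool ∘ st) (fromBool ∘ ts)))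
  where
  st ts : Fin n → Bool
  st k = isPos (s k) ∧ isNeg (t k)
  ts k = isPos (t k) ∧ isNeg (s k)

litConflict-agree : ∀ a c b → litSat a b ≡ true → litSat c b ≡ true → litConflict a c ≡ 0
litConflict-agree pos    pos    _     _  _  = refl
litConflict-agree neg    neg    _     _  _  = refl
litConflict-agree pos    absent _     _  _  = refl
litConflict-agree neg    absent _     _  _  = refl
litConflict-agree absent pos    _     _  _  = refl
litConflict-agree absent neg    _     _  _  = refl
litConflict-agree absent absent _     _  _  = refl
litConflict-agree pos    neg    true  _  ()
litConflict-agree pos    neg    false () _
litConflict-agree neg    pos    true  () _
litConflict-agree neg    pos    false _  ()

litConflict-disagree : ∀ a c b → isLit a ≡ true → isLit c ≡ true →
  litSat a b ≡ true → litSat c (not b) ≡ true → litConflict a c ≡ 1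
litConflict-disagree pos    neg    _     _  _  _  _  = refl
litConflict-disagree neg    pos    _     _  _  _  _  = refl
litConflict-disagree pos    pos    true  _  _  _  ()
litConflict-disagree pos    pos    false _  _  () _
litConflict-disagree neg    neg    true  _  _  () _
litConflict-disagree neg    neg    false _  _  _  ()
litConflict-disagree absent _      _     () _  _  _
litConflict-disagree pos    absent _     _  () _  _
litConflict-disagree neg    absent _     _  () _  _

flipBit-conflict : ∀ {n} (s t : Term n) x k → isLit (s k) ≡ true → Sat s x →
  satTerm t x ≡ false → Sat t (flipBit k x) → litConflict (s k) (t k) ≡ 1 × conflicts s t ≡ 1
flipBit-conflict s t x k k∈s sat unsat sat′ = conflict-k , conflicts≡1
  where
  sat′-self : litSat (t k) (not (lookup x k)) ≡ true
  sat′-self = subst (λ b → litSat (t k) b ≡ true) (lookup-flipBit-self k x) (sat′ k)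
  k∈t : isLit (t k) ≡ true
  k∈t with isLit (t k) in k∉t
  ... | true  = refl
  ... | false = trans (sym unsat)
    (satTerm-agreeOutside t (flipBit k x) x k k∉t (λ l l≢k → sym (lookup-flipBit-outside x l≢k)) sat′)
  conflict-k : litConflict (s k) (t k) ≡ 1
  conflict-k = litConflict-disagree (s k) (t k) (lookup x k) k∈s k∈t (sat k) sat′-self
  no-conflict : ∀ l → l ≢ k → litConflict (s l) (t l) ≡ 0
  no-conflict l l≢k = litConflict-agree (s l) (t l) (lookup x l) (sat l)
    (subst (λ b → litSat (t l) b ≡ true) (lookup-flipBit-outside x l≢k) (sat′ l))
  conflicts≡1 : conflicts s t ≡ 1
  conflicts≡1 = trans (conflicts≡sum s t) (trans (sum-single _ k no-conflict) conflict-k)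

eval-satTerm : ∀ {n m} (D : DNF n m) {i} x → satTerm (D i) x ≡ true → eval D x ≡ true
eval-satTerm D {i} x = anyFinB-complete (λ j → satTerm (D j) x) i

sensitivity≤termWidth : ∀ {n m} (D : DNF n m) {i} x → satTerm (D i) x ≡ true →
  sens (eval D) x ≤ termWidth (D i)
sensitivity≤termWidth {n} D {i} x sat = begin
  sens (eval D) x                    ≡⟨ countFin≡sum sensitiveAt ⟩
  sum (fromBool ∘ sensitiveAt)       ≤⟨ sum-mono-≤ sensitive⇒literal ⟩
  sum (λ k → fromBool (isLit (D i k))) ≡⟨ countFin≡sum (λ k → isLit (D i k)) ⟨
  termWidth (D i)                    ∎
  where
  open ≤-Reasoning
  sensitiveAt : Fin n → Bool
  sensitiveAt k = eval D x xor eval D (flipBit k x)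
  sensitive⇒literal : ∀ k → fromBool (sensitiveAt k) ≤ fromBool (isLit (D i k))
  sensitive⇒literal k with isLit (D i k) in k∉i
  ... | true  = fromBool≤1 _
  ... | false =
    ≤-reflexive (cong₂ (λ a b → fromBool (a xor b)) (eval-satTerm D x sat) (eval-satTerm D (flipBit k x) sat′))
    where
    sat′ : satTerm (D i) (flipBit k x) ≡ true
    sat′ = satTerm-agreeOutside (D i) x (flipBit k x) k k∉i (λ l → lookup-flipBit-outside x)
                                (satTerm-sound (D i) x sat)

OnlySatisfies : ∀ {n m} → DNF n m → Fin m → Input n → Set
OnlySatisfies D i x = satTerm (D i) x ≡ true × (∀ j → j ≢ i → satTerm (D j) x ≡ false)

inΓ : ∀ {n m} → DNF n m → Fin m → Fin m → ℕ
inΓ D i j = fromBool (isOne (conflicts (D i) (D j)))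

-- inΓ D i j * litConflict (D i k) (D j k) ≡ 1 says that j ∈ Γᵢ and that ∧ᵢ, ∧ⱼ conflict at k.
insensitive-literal-conflict : ∀ {n m} (D : DNF n m) {i} x → OnlySatisfies D i x → ∀ {k} →
  isLit (D i k) ≡ true → eval D (flipBit k x) ≡ true → ∃ λ j → inΓ D i j * litConflict (D i k) (D j k) ≡ 1
insensitive-literal-conflict D {i} x (sat , others) {k} k∈i flipped with anyFinB-sound _ flipped
... | j , sat′ = j , Γ-term≡1
  where
  j≢i : j ≢ i
  j≢i refl = Sat-flipBit (D i) x k k∈i (satTerm-sound (D i) x sat) (satTerm-sound (D i) (flipBit k x) sat′)
  conflict : litConflict (D i k) (D j k) ≡ 1 × conflicts (D i) (D j) ≡ 1
  conflict = flipBit-conflict (D i) (D j) x k k∈i (satTerm-sound (D i) x sat) (others j j≢i)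
                               (satTerm-sound (D j) (flipBit k x) sat′)
  Γ-term≡1 : inΓ D i j * litConflict (D i k) (D j k) ≡ 1
  Γ-term≡1 rewrite proj₁ conflict | proj₂ conflict = refl

literal≤sensitive+conflicts : ∀ {n m} (D : DNF n m) {i} x → OnlySatisfies D i x → ∀ k →
  fromBool (isLit (D i k)) ≤
    fromBool (eval D x xor eval D (flipBit k x)) + sum (λ j → inΓ D i j * litConflict (D i k) (D j k))
literal≤sensitive+conflicts D {i} x only k with isLit (D i k) in k∈i
... | false = z≤n
... | true with eval D (flipBit k x) in flipped
...   | false = ≤-trans (≤-reflexive (cong (λ a → fromBool (a xor false)) (sym (eval-satTerm D x (proj₁ only)))))
                        (m≤m+n _ _)
...   | true with insensitive-literal-conflict D x only k∈i flipped
...     | j , Γ-term≡1 = ≤-trans (≤-reflexive (sym Γ-term≡1)) (≤-trans (≤-sum _ j) (m≤n+m _ _))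

∑-Γ-conflicts≡GammaSize : ∀ {n m} (D : DNF n m) i →
  sum (λ k → sum (λ j → inΓ D i j * litConflict (D i k) (D j k))) ≡ GammaSize D i
∑-Γ-conflicts≡GammaSize D i = begin
  sum (λ k → sum (λ j → inΓ D i j * litConflict (D i k) (D j k)))
    ≡⟨ ∑-comm (λ k j → inΓ D i j * litConflict (D i k) (D j k)) ⟩
  sum (λ j → sum (λ k → inΓ D i j * litConflict (D i k) (D j k)))
    ≡⟨ sum-cong-≗ (λ j → sym (*-distribˡ-sum (inΓ D i j) (λ k → litConflict (D i k) (D j k)))) ⟩
  sum (λ j → inΓ D i j * sum (λ k → litConflict (D i k) (D j k)))
    ≡⟨ sum-cong-≗ (λ j → cong (inΓ D i j *_) (conflicts≡sum (D i) (D j))) ⟨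
  sum (λ j → inΓ D i j * conflicts (D i) (D j))
    ≡⟨ sum-cong-≗ (λ j → fromBool-isOne-* (conflicts (D i) (D j))) ⟩
  sum (inΓ D i)
    ≡⟨ countFin≡sum (λ j → isOne (conflicts (D i) (D j))) ⟨
  GammaSize D i ∎
  where open ≡-Reasoning

termWidth≤GammaSize+sensitivity : ∀ {n m} (D : DNF n m) {i} x → OnlySatisfies D i x →
  termWidth (D i) ≤ GammaSize D i + sens (eval D) x
termWidth≤GammaSize+sensitivity {n} D {i} x only = begin
  termWidth (D i)                   ≡⟨ countFin≡sum (λ k → isLit (D i k)) ⟩
  sum (λ k → fromBool (isLit (D i k))) ≤⟨ sum-mono-≤ (literal≤sensitive+conflicts D x only) ⟩
  sum (λ k → sensitiveAt k + conflictsAt k) ≡⟨ ∑-distrib-+ sensitiveAt conflictsAt ⟩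
  sum sensitiveAt + sum conflictsAt ≡⟨ cong₂ _+_ (sym (countFin≡sum (λ k → eval D x xor eval D (flipBit k x))))
                                                  (∑-Γ-conflicts≡GammaSize D i) ⟩
  sens (eval D) x + GammaSize D i   ≡⟨ +-comm (sens (eval D) x) (GammaSize D i) ⟩
  GammaSize D i + sens (eval D) x   ∎
  where
  open ≤-Reasoning
  sensitiveAt conflictsAt : Fin n → ℕ
  sensitiveAt k = fromBool (eval D x xor eval D (flipBit k x))
  conflictsAt k = sum (λ j → inΓ D i j * litConflict (D i k) (D j k))

lemma2 : ∀ (n m : ℕ) (D : DNF n m) → Compact D →
           (width D ∸ Gamma D ≤ s1 (eval D)) × (s1 (eval D) ≤ width D)
lemma2 n m D (_ , _ , onlySatisfies) = lower , upper
  where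
  upper : s1 (eval D) ≤ width D
  upper = s1-lub (eval D) λ x fx →
    let i , sat = anyFinB-sound _ fx
    in ≤-trans (sensitivity≤termWidth D x sat) (maxFin-upper (λ j → termWidth (D j)) i)
  termWidth≤Gamma+s1 : ∀ i → termWidth (D i) ≤ Gamma D + s1 (eval D)
  termWidth≤Gamma+s1 i =
    let x , only = onlySatisfies i
    in ≤-trans (termWidth≤GammaSize+sensitivity D x only)
               (+-mono-≤ (maxFin-upper (GammaSize D) i) (sens≤s1 (eval D) x (eval-satTerm D x (proj₁ only))))
  lower : width D ∸ Gamma D ≤ s1 (eval D)
  lower = m≤n+o⇒m∸n≤o (width D) (Gamma D) (maxFin-lub (λ i → termWidth (D i)) termWidth≤Gamma+s1)
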